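{- Let $d_\ell(m)=2^{ -2m}\sum_{k=\ell}^m 2^k \binom{2m-2k}{m-k}\binom{m+k}{k}\binom{k}{\ell}$ for integers $m\geq \ell\geq 0$. For every $m\geq 2$ and $1\leq \ell\leq m-1$, \[ \frac{d_\ell(m)^2}{d_{\ell-1}(m)d_{\ell+1}(m)}>\frac{(m-\ell+1)(\ell+1)(m+\ell^2)}{(m-\ell)\ell(m+\ell^2+1)}. \]
   Context: The numbers $d_\ell(m)$ are the Boros–Moll coefficients (coefficients of $x^\ell$ in the Boros–Moll polynomial $P_m(x)$); they are positive for $0\le \ell\le m$. -}

module Defs where

open import Data.Nat as ℕ using (ℕ; zero; suc; _∸_; _^_)
open import Data.Nat.Combinatorics using (_C_)
open import Data.Integer as ℤ using (ℤ; +_)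
open import Data.Rational as ℚ using (ℚ; 0ℚ; _/_; _*_; _÷_)
open import Relation.Nullary using (yes; no)
open import Data.Nat.Properties using (m^n>0)

-- Σ_{k=ℓ}^{m} f k  (empty sum = 0 when ℓ > m)
sumFromTo : ℕ → ℕ → (ℕ → ℕ) → ℕ
sumFromTo ℓ zero f with ℓ ℕ.≟ 0
... | yes _ = f 0
... | no _ = 0
sumFromTo ℓ (suc m) f with ℓ ℕ.≤? suc m
... | yes _ = sumFromTo ℓ m f ℕ.+ f (suc m)
... | no _ = 0

dNum : ℕ → ℕ → ℕ
dNum ℓ m = sumFromTo ℓ m (λ k → 2 ^ k ℕ.* ((2 ℕ.* m ∸ 2 ℕ.* k) C (m ∸ k))
                                   ℕ.* ((m ℕ.+ k) C k) ℕ.* (k C ℓ))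

d : ℕ → ℕ → ℚ
d ℓ m = (+ dNum ℓ m) / (2 ^ (2 ℕ.* m))
  where instance _ = ℕ.>-nonZero (m^n>0 2 (2 ℕ.* m))

-- total division on ℚ (x ÷ 0 := 0); only used with nonzero denominators
_÷'_ : ℚ → ℚ → ℚ
p ÷' q with q ℚ.≟ 0ℚ
... | yes _ = 0ℚ
... | no q≢0 = p ÷ q
  where instance _ = ℚ.≢-nonZero q≢0

ι : ℕ → ℚ
ι n = (+ n) / 1

module Submission where

-- Write xⱼ = 2^{2m} dⱼ(m) = Σₖ wₖ C(k, j), where wₖ = 2^k C(2m-2k, m-k) C(m+k, k).  Since
-- (k+1)(2m-2k-1) wₖ₊₁ = (m-k)(m+k+1) wₖ, the summands of the three-term recurrence
--   ℓ(2m+1) x_ℓ = ℓ(ℓ+1) x_{ℓ+1} + (m+ℓ)(m-ℓ+1) x_{ℓ-1}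
-- telescope.  Modulo this recurrence, ℓ times the cleared difference of the two sides of the
-- theorem is Q_ℓ(ℓ x_ℓ, (m-ℓ+1) x_{ℓ-1}) for the binary quadratic form
--   Q_ℓ(u, w) = (m-ℓ)(m+ℓ²+1) u² - (m+ℓ²)(2m+1) u w + (m+ℓ²)(m+ℓ) w².
-- Positivity of this value, together with u < w, follows by descending induction on ℓ.  At ℓ = m
-- the form vanishes.  The recurrence expresses ℓ times the point for ℓ+1 linearly in the point for
-- ℓ, so the hypothesis says R ≥ 0 for the form R = Q_{ℓ+1} ∘ (that linear map).  A polynomial
-- certificate finishes the step: with R̂, Q̂ the values of R, Q_ℓ at (m+ℓ, m+ℓ+1), the form
-- R̂ Q_ℓ - Q̂ R is divisible by (m+ℓ)w - (m+ℓ+1)u, while R̂ < 0, Q̂ ≤ 0 and the coefficients of the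
-- cofactor are polynomials in ℓ-1 and m-ℓ-1 with nonnegative coefficients.

open import Data.Nat using (ℕ; zero; suc; z≤n; s≤s)
open import Data.List using (List; []; _∷_)
open import Data.Product using (_×_; _,_; proj₁; map₁)
open import Relation.Binary.PropositionalEquality
open import Relation.Nullary using (yes; no; contradiction)
open import Defs

module Binomial where

  open import Data.Nat
  open import Data.Nat.Properties
  open import Data.Nat.Combinatorics using (_C_; nC1≡n; nCk≡nC[n∸k]; nCk+nC[k+1]≡[n+1]C[k+1])
  open import Data.Nat.Tactic.RingSolver using (solve-∀)
  open ≡-Reasoning

  C-absorb : ∀ n k → suc k * (suc n C suc k) ≡ suc n * (n C k)
  C-absorb zero    zero    = refl
  C-absorb zero    (suc k) = *-zeroʳ (suc (suc k))
  C-absorb (suc n) zero    = trans (*-identityˡ _) (trans (nC1≡n (suc (suc n))) (sym (*-identityʳ (suc (suc n)))))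
  C-absorb (suc n) (suc k) = begin
    suc (suc k) * (suc (suc n) C suc (suc k))            ≡⟨ cong (suc (suc k) *_) (nCk+nC[k+1]≡[n+1]C[k+1] (suc n) (suc k)) ⟨
    suc (suc k) * (c + suc n C suc (suc k))              ≡⟨ distribute (suc k) c (suc n C suc (suc k)) ⟩
    c + suc k * c + suc (suc k) * (suc n C suc (suc k))  ≡⟨ cong₂ (λ x y → c + x + y) (C-absorb n k) (C-absorb n (suc k)) ⟩
    c + suc n * (n C k) + suc n * (n C suc k)            ≡⟨ +-assoc c _ _ ⟩
    c + (suc n * (n C k) + suc n * (n C suc k))          ≡⟨ cong (c +_) (*-distribˡ-+ (suc n) (n C k) (n C suc k)) ⟨
    c + suc n * (n C k + n C suc k)                      ≡⟨ cong (λ x → c + suc n * x) (nCk+nC[k+1]≡[n+1]C[k+1] n k) ⟩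
    suc (suc n) * c                                      ∎
    where
    c = suc n C suc k
    distribute : ∀ a x y → suc a * (x + y) ≡ x + a * x + suc a * y
    distribute = solve-∀

  C-pos : ∀ {n k} → k ≤ n → 0 < n C k
  C-pos {n}     {zero}  _         = s≤s z≤n
  C-pos {suc n} {suc k} (s≤s k≤n) =
    <-≤-trans (C-pos k≤n) (subst (n C k ≤_) (nCk+nC[k+1]≡[n+1]C[k+1] n k) (m≤m+n (n C k) (n C suc k)))

  C-step : ∀ k j → suc j * (k C suc j) + suc j * (k C j) ≡ suc k * (k C j)
  C-step k j = begin
    suc j * (k C suc j) + suc j * (k C j) ≡⟨ *-distribˡ-+ (suc j) (k C suc j) (k C j) ⟨
    suc j * (k C suc j + k C j)           ≡⟨ cong (suc j *_) (+-comm (k C suc j) (k C j)) ⟩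
    suc j * (k C j + k C suc j)           ≡⟨ cong (suc j *_) (nCk+nC[k+1]≡[n+1]C[k+1] k j) ⟩
    suc j * (suc k C suc j)               ≡⟨ C-absorb k j ⟩
    suc k * (k C j)                       ∎

  C-central : ∀ t → suc t * (2 * suc t C suc t) ≡ 2 * (2 * t + 1) * (2 * t C t)
  C-central t = begin
    suc t * (2 * suc t C suc t)    ≡⟨ cong (λ n → suc t * (n C suc t)) (double-suc t) ⟩
    suc t * (suc (suc N) C suc t)  ≡⟨ C-absorb (suc N) t ⟩
    suc (suc N) * (suc N C t)      ≡⟨ cong (suc (suc N) *_) middle-symmetric ⟩
    suc (suc N) * (suc N C suc t)  ≡⟨ double-suc-* t (suc N C suc t) ⟩
    2 * (suc t * (suc N C suc t))  ≡⟨ cong (2 *_) (C-absorb N t) ⟩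
    2 * (suc N * (N C t))          ≡⟨ reassociate t (N C t) ⟩
    2 * (2 * t + 1) * (N C t)      ∎
    where
    N = 2 * t
    double-suc : ∀ t → 2 * suc t ≡ suc (suc (2 * t))
    double-suc = solve-∀
    double-suc-* : ∀ t y → suc (suc (2 * t)) * y ≡ 2 * (suc t * y)
    double-suc-* = solve-∀
    reassociate : ∀ t y → 2 * (suc (2 * t) * y) ≡ 2 * (2 * t + 1) * y
    reassociate = solve-∀
    middle-symmetric : suc N C t ≡ suc N C suc t
    middle-symmetric = begin
      suc N C t               ≡⟨ nCk≡nC[n∸k] (m≤n⇒m≤1+n (m≤m+n t (t + 0))) ⟩
      suc N C (suc N ∸ t)     ≡⟨ cong (λ n → suc N C (suc n ∸ t)) (cong (t +_) (+-identityʳ t)) ⟩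
      suc N C (suc t + t ∸ t) ≡⟨ cong (suc N C_) (m+n∸n≡m (suc t) t) ⟩
      suc N C suc t           ∎

  weight : ℕ → ℕ → ℕ
  weight m k = 2 ^ k * ((2 * m ∸ 2 * k) C (m ∸ k)) * ((m + k) C k)

  weight-shifted : ∀ k s → weight (k + s) k ≡ 2 ^ k * (2 * s C s) * ((k + s + k) C k)
  weight-shifted k s = cong (λ c → 2 ^ k * c * ((k + s + k) C k)) (cong₂ _C_ doubled (m+n∸m≡n k s))
    where
    doubled : 2 * (k + s) ∸ 2 * k ≡ 2 * s
    doubled = trans (cong (_∸ 2 * k) (*-distribˡ-+ 2 k s)) (m+n∸m≡n (2 * k) (2 * s))

  weight-pos : ∀ m → 0 < weight m m
  weight-pos m = subst (λ n → 0 < weight n m) (+-identityʳ m) (subst (0 <_) (sym (weight-shifted m 0)) positive)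
    where
    positive : 0 < 2 ^ m * (2 * 0 C 0) * ((m + 0 + m) C m)
    positive = *-mono-< (*-mono-< (m^n>0 2 m) (s≤s z≤n)) (C-pos (m≤n+m m (m + 0)))

  weight-recurrence : ∀ k t → let m = k + suc t in
    suc k * (2 * t + 1) * weight m (suc k) ≡ suc t * (m + suc k) * weight m k
  weight-recurrence k t = begin
    suc k * (2 * t + 1) * weight m (suc k)                   ≡⟨ cong (λ n → suc k * (2 * t + 1) * weight n (suc k)) (+-suc k t) ⟩
    suc k * (2 * t + 1) * weight (suc k + t) (suc k)         ≡⟨ cong (suc k * (2 * t + 1) *_) (weight-shifted (suc k) t) ⟩
    suc k * (2 * t + 1) * (2 ^ suc k * (2 * t C t) * b₁)     ≡⟨ regroup k t (2 ^ k) (2 * t C t) b₁ ⟩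
    2 ^ k * (2 * (2 * t + 1) * (2 * t C t)) * (suc k * b₁)   ≡⟨ cong₂ (λ x y → 2 ^ k * x * y) (C-central t) absorbed ⟨
    2 ^ k * (suc t * c) * ((m + suc k) * b)                  ≡⟨ regroup′ (suc t) (2 ^ k) c (m + suc k) b ⟩
    suc t * (m + suc k) * (2 ^ k * c * b)                    ≡⟨ cong (suc t * (m + suc k) *_) (weight-shifted k (suc t)) ⟨
    suc t * (m + suc k) * weight m k                         ∎
    where
    m  = k + suc t
    c  = 2 * suc t C suc t
    b  = (m + k) C k
    b₁ = (suc k + t + suc k) C suc k
    same-top : ∀ k t → suc k + t + suc k ≡ suc (k + suc t + k)
    same-top = solve-∀
    absorbed : (m + suc k) * b ≡ suc k * b₁
    absorbed = begin
      (m + suc k) * b               ≡⟨ cong (_* b) (+-suc m k) ⟩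
      suc (m + k) * b               ≡⟨ C-absorb (m + k) k ⟨
      suc k * (suc (m + k) C suc k) ≡⟨ cong (λ n → suc k * (n C suc k)) (same-top k t) ⟨
      suc k * b₁                    ∎
    regroup : ∀ k t p c b → suc k * (2 * t + 1) * (2 * p * c * b) ≡ p * (2 * (2 * t + 1) * c) * (suc k * b)
    regroup = solve-∀
    regroup′ : ∀ s p c n b → p * (s * c) * (n * b) ≡ s * n * (p * c * b)
    regroup′ = solve-∀

-- Polynomials are written once over an abstract arithmetic and instantiated both at ℤ and at the
-- ring solver's syntax Expr ℤ n.  Evaluating the syntactic instance yields the integer one
-- definitionally, so `solve` of Tactic.RingSolver.NonReflective proves identities between the
-- named polynomials below without unfolding them by hand.
record Arithmetic (K : Set) : Set where
  infixl 6 _+_ _-_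
  infixl 7 _*_
  infix  8 -_ #_
  field
    _+_ _*_ : K → K → K
    -_      : K → K
    #_      : ℕ → K

  _-_ : K → K → K
  x - y = x + - y

module Polynomials {K : Set} (arithmetic : Arithmetic K) where
  open Arithmetic arithmetic public

  horner : List ℕ → K → K
  horner []       x = # 0
  horner (c ∷ cs) x = # c + x * horner cs x

  horner₂ : List (List ℕ) → K → K → K
  horner₂ []       x y = # 0
  horner₂ (p ∷ ps) x y = horner p y + x * horner₂ ps x y

  form : K → K → K → K → K → K
  form a b c u w = a * u * u + b * u * w + c * w * w

  recurrence : K → K → K → K → K → K
  recurrence L M x₀ x₁ x₂ = L * (# 2 * M + # 1) * x₁ - L * (L + # 1) * x₂ - (M + L) * (M - L + # 1) * x₀

  bound-numerator bound-denominator : K → K → K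
  bound-numerator   L M = (# 1 + M - L) * (L + # 1) * (M + L * L)
  bound-denominator L M = (M - L) * L * (M + L * L + # 1)

  module _ (L M : K) where
    q₂ q₁ q₀ : K
    q₂ = (M - L) * (M + L * L + # 1)
    q₁ = - ((M + L * L) * (# 2 * M + # 1))
    q₀ = (M + L * L) * (M + L)

  Q : K → K → K → K → K
  Q L M = form (q₂ L M) (q₁ L M) (q₀ L M)

  -- The coefficients of (u, w) ↦ Q (1 + L) M ((2M+1)u - (M+L)w, (M-L)u), cf. R-substitution.
  module _ (L M : K) where
    r₂ r₁ r₀ : K
    r₂ = Q (# 1 + L) M (# 2 * M + # 1) (M - L)
    r₁ = - (# 2 * q₂ (# 1 + L) M * (# 2 * M + # 1) * (M + L)) - q₁ (# 1 + L) M * (M + L) * (M - L)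
    r₀ = q₂ (# 1 + L) M * (M + L) * (M + L)

  R : K → K → K → K → K
  R L M = form (r₂ L M) (r₁ L M) (r₀ L M)

  -- R̂·(q-form) - Q̂·(r-form) vanishes at (b, a), hence is divisible by b w - a u; c₁ and c₃
  -- describe the cofactor, see certificate-identity.
  module Certificate (q₂ q₁ q₀ r₂ r₁ r₀ a b : K) where
    Q̂ R̂ c₁ c₃ : K
    Q̂  = form q₂ q₁ q₀ b a
    R̂  = form r₂ r₁ r₀ b a
    c₁ = - (R̂ * q₀ - Q̂ * r₀)
    c₃ = (R̂ * q₂ - Q̂ * r₂) * b * b - (R̂ * q₀ - Q̂ * r₀) * a * a

  module CertificateAt (L M : K) = Certificate (q₂ L M) (q₁ L M) (q₀ L M) (r₂ L M) (r₁ L M) (r₀ L M) (M + L + # 1) (M + L)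

module Integers where

  open import Data.Nat as ℕ using ()
  import Data.Nat.Properties as ℕ
  open import Data.Nat.Combinatorics using (_C_)
  open import Data.Nat.Combinatorics.Specification using (k>n⇒nCk≡0)
  open import Data.Integer using (ℤ; +_; 0ℤ; _+_; _*_; -_; _-_; _≤_; _<_; +≤+; +<+; +[1+_])
  open import Data.Integer.Properties
    using ( +-mono-≤; +-mono-<-≤; +-mono-≤-<; +-monoˡ-<; *-cancelˡ-<-nonNeg; *-zeroʳ; <⇒≤
          ; pos-*; pos-+; +-inverseʳ; +-identityˡ)
  open import Data.Integer.Tactic.RingSolver using (ring; solve-∀)
  open import Tactic.RingSolver.NonReflective ring using (solve; _⊜_; _⊕_; _⊗_; ⊝_; Expr; Κ)
  open Binomial using (weight; weight-pos; weight-recurrence; C-pos; C-step; C-absorb)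

  ℤ-arithmetic : Arithmetic ℤ
  ℤ-arithmetic = record { _+_ = _+_ ; _*_ = _*_ ; -_ = -_ ; #_ = +_ }

  expr-arithmetic : ∀ n → Arithmetic (Expr ℤ n)
  expr-arithmetic n = record { _+_ = _⊕_ ; _*_ = _⊗_ ; -_ = ⊝_ ; #_ = λ c → Κ (+ c) }

  open Polynomials ℤ-arithmetic
    using (horner; horner₂; form; recurrence; bound-numerator; bound-denominator; Q; R; q₂; q₁; q₀; r₂; r₁; r₀;
           module Certificate; module CertificateAt)
  module E {n} = Polynomials (expr-arithmetic n)

  *-pos : ∀ {a b} → 0ℤ < a → 0ℤ < b → 0ℤ < a * b
  *-pos {+[1+ m ]} {+[1+ n ]} _        _        = +<+ (s≤s z≤n)
  *-pos {+ zero}   {_}        (+<+ ()) _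
  *-pos {+[1+ m ]} {+ zero}   _        (+<+ ())

  *-nonNeg : ∀ {a b} → 0ℤ ≤ a → 0ℤ ≤ b → 0ℤ ≤ a * b
  *-nonNeg {+ m} {+ n} _ _ = subst (0ℤ ≤_) (pos-* m n) (+≤+ z≤n)

  0<i*j⇒0<j : ∀ {i j} → 0ℤ < i → 0ℤ < i * j → 0ℤ < j
  0<i*j⇒0<j {i@(+[1+ _ ])} {j} _ 0<ij = *-cancelˡ-<-nonNeg i (subst (_< i * j) (sym (*-zeroʳ i)) 0<ij)
  0<i*j⇒0<j {+ zero} (+<+ ()) _

  0≤i⇒0<1+i : ∀ {i} → 0ℤ ≤ i → 0ℤ < + 1 + i
  0≤i⇒0<1+i = +-mono-<-≤ (+<+ (s≤s z≤n))

  0<j-i⇒i<j : ∀ {i j} → 0ℤ < j - i → i < j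
  0<j-i⇒i<j {i} {j} 0<j-i = subst₂ _<_ (+-identityˡ i) (cancel j i) (+-monoˡ-< i 0<j-i)
    where
    cancel : ∀ j i → j - i + i ≡ j
    cancel = solve-∀

  i<j⇒0<j-i : ∀ {i j} → i < j → 0ℤ < j - i
  i<j⇒0<j-i {i} {j} i<j = subst (_< j - i) (+-inverseʳ i) (+-monoˡ-< (- i) i<j)

  pos-*₃ : ∀ a b c → + (a ℕ.* b ℕ.* c) ≡ + a * + b * + c
  pos-*₃ a b c = trans (pos-* (a ℕ.* b) c) (cong (_* + c) (pos-* a b))

  -- How an equation p ≡ p′ enters a ring-solver proof: solve x = y + a (p - p′), then cancel.
  eq-modulo : ∀ {x} y a {p p′} → x ≡ y + a * (p - p′) → p ≡ p′ → x ≡ y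
  eq-modulo y a {p} eq refl = trans eq (vanish y a p)
    where
    vanish : ∀ y a p → y + a * (p - p) ≡ y
    vanish = solve-∀

  eq-modulo₂ : ∀ {x} y a b {p p′ q q′} → x ≡ y + a * (p - p′) + b * (q - q′) → p ≡ p′ → q ≡ q′ → x ≡ y
  eq-modulo₂ y a b {p} {q = q} eq refl refl = trans eq (vanish y a b p q)
    where
    vanish : ∀ y a b p q → y + a * (p - p) + b * (q - q) ≡ y
    vanish = solve-∀

  horner-nonNeg : ∀ cs {x} → 0ℤ ≤ x → 0ℤ ≤ horner cs x
  horner-nonNeg []       _   = +≤+ z≤n
  horner-nonNeg (c ∷ cs) x≥0 = +-mono-≤ (+≤+ z≤n) (*-nonNeg x≥0 (horner-nonNeg cs x≥0))

  horner₂-nonNeg : ∀ css {x y} → 0ℤ ≤ x → 0ℤ ≤ y → 0ℤ ≤ horner₂ css x y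
  horner₂-nonNeg []         _   _   = +≤+ z≤n
  horner₂-nonNeg (cs ∷ css) x≥0 y≥0 = +-mono-≤ (horner-nonNeg cs y≥0) (*-nonNeg x≥0 (horner₂-nonNeg css x≥0 y≥0))

  Σ : ℕ → (ℕ → ℤ) → ℤ
  Σ zero    f = 0ℤ
  Σ (suc n) f = Σ n f + f n

  Σ-cong : ∀ n {f h : ℕ → ℤ} → (∀ {k} → k ℕ.< n → f k ≡ h k) → Σ n f ≡ Σ n h
  Σ-cong zero    eq = refl
  Σ-cong (suc n) eq = cong₂ _+_ (Σ-cong n (λ k<n → eq (ℕ.m<n⇒m<1+n k<n))) (eq ℕ.≤-refl)

  Σ-zero : ∀ n {f : ℕ → ℤ} → (∀ {k} → k ℕ.< n → f k ≡ 0ℤ) → Σ n f ≡ 0ℤ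
  Σ-zero zero    eq = refl
  Σ-zero (suc n) eq = cong₂ _+_ (Σ-zero n (λ k<n → eq (ℕ.m<n⇒m<1+n k<n))) (eq ℕ.≤-refl)

  Σ-nonNeg : ∀ n {f : ℕ → ℤ} → (∀ k → 0ℤ ≤ f k) → 0ℤ ≤ Σ n f
  Σ-nonNeg zero    f≥0 = +≤+ z≤n
  Σ-nonNeg (suc n) f≥0 = +-mono-≤ (Σ-nonNeg n f≥0) (f≥0 n)

  Σ-pos : ∀ n {f : ℕ → ℤ} → (∀ k → 0ℤ ≤ f k) → 0ℤ < f n → 0ℤ < Σ (suc n) f
  Σ-pos n f≥0 fn>0 = +-mono-≤-< (Σ-nonNeg n f≥0) fn>0

  Σ-telescope : ∀ n {f h : ℕ → ℤ} → (∀ {k} → k ℕ.< n → f (suc k) ≡ h k) →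
    Σ (suc n) (λ k → f k - h k) ≡ f 0 - h n
  Σ-telescope zero    {f} {h} eq = +-identityˡ (f 0 - h 0)
  Σ-telescope (suc n) {f} {h} eq = begin
    Σ (suc n) (λ k → f k - h k) + (f (suc n) - h (suc n))
      ≡⟨ cong₂ (λ x y → x + (y - h (suc n))) (Σ-telescope n {f} {h} (λ k<n → eq (ℕ.m<n⇒m<1+n k<n))) (eq ℕ.≤-refl) ⟩
    f 0 - h n + (h n - h (suc n))
      ≡⟨ telescoped (f 0) (h n) (h (suc n)) ⟩
    f 0 - h (suc n) ∎
    where
    open ≡-Reasoning
    telescoped : ∀ a b c → a - b + (b - c) ≡ a - c
    telescoped = solve-∀

  sumFromTo≡Σ : ∀ ℓ m f → (∀ {k} → k ℕ.< ℓ → f k ≡ 0) → + sumFromTo ℓ m f ≡ Σ (suc m) (λ k → + f k)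
  sumFromTo≡Σ ℓ zero f below with ℓ ℕ.≟ 0
  ... | yes _  = refl
  ... | no ℓ≢0 = cong +_ (sym (below (ℕ.n≢0⇒n>0 ℓ≢0)))
  sumFromTo≡Σ ℓ (suc m) f below with ℓ ℕ.≤? suc m
  ... | yes _ = trans (pos-+ (sumFromTo ℓ m f) (f (suc m))) (cong (_+ + f (suc m)) (sumFromTo≡Σ ℓ m f below))
  ... | no ℓ≰ = sym (Σ-zero (suc (suc m)) (λ k<2+m → cong +_ (below (ℕ.<-≤-trans k<2+m (ℕ.≰⇒> ℓ≰)))))

  recurrence-+ : ∀ L M x₀ x₁ x₂ y₀ y₁ y₂ →
    recurrence L M (x₀ + y₀) (x₁ + y₁) (x₂ + y₂) ≡ recurrence L M x₀ x₁ x₂ + recurrence L M y₀ y₁ y₂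
  recurrence-+ = solve 8 (λ L M x₀ x₁ x₂ y₀ y₁ y₂ →
    E.recurrence L M (x₀ ⊕ y₀) (x₁ ⊕ y₁) (x₂ ⊕ y₂)
      ⊜ (E.recurrence L M x₀ x₁ x₂ ⊕ E.recurrence L M y₀ y₁ y₂)) refl

  Σ-recurrence : ∀ n L M (x₀ x₁ x₂ : ℕ → ℤ) →
    Σ n (λ k → recurrence L M (x₀ k) (x₁ k) (x₂ k)) ≡ recurrence L M (Σ n x₀) (Σ n x₁) (Σ n x₂)
  Σ-recurrence zero    L M x₀ x₁ x₂ = solve 2 (λ L M → E.# 0 ⊜ E.recurrence L M (E.# 0) (E.# 0) (E.# 0)) refl L M
  Σ-recurrence (suc n) L M x₀ x₁ x₂ =
    trans (cong (_+ recurrence L M (x₀ n) (x₁ n) (x₂ n)) (Σ-recurrence n L M x₀ x₁ x₂))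
      (sym (recurrence-+ L M (Σ n x₀) (Σ n x₁) (Σ n x₂) (x₀ n) (x₁ n) (x₂ n)))

  -- The three-term recurrence

  C-absorbℤ : ∀ k n → + suc n * + (suc k C suc n) ≡ + suc k * + (k C n)
  C-absorbℤ k n = trans (sym (pos-* (suc n) (suc k C suc n))) (trans (cong +_ (C-absorb k n)) (pos-* (suc k) (k C n)))

  C-stepℤ : ∀ k j → + suc j * + (k C suc j) ≡ (+ k - + j) * + (k C j)
  C-stepℤ k j = eq-modulo ((+ k - + j) * + (k C j)) (+ 1) (rearrange (+ k) (+ j) (+ (k C j)) (+ suc j * + (k C suc j))) summed
    where
    summed : + suc j * + (k C suc j) + + suc j * + (k C j) ≡ + suc k * + (k C j)
    summed = trans (sym (cong₂ _+_ (pos-* (suc j) (k C suc j)) (pos-* (suc j) (k C j))))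
      (trans (sym (pos-+ (suc j ℕ.* (k C suc j)) (suc j ℕ.* (k C j)))) (trans (cong +_ (C-step k j)) (pos-* (suc k) (k C j))))
    rearrange : ∀ K J B A → A ≡ (K - J) * B + + 1 * (A + (+ 1 + J) * B - (+ 1 + K) * B)
    rearrange = solve-∀

  weight-recurrenceℤ : ∀ k t → let m = k ℕ.+ suc t in
    + suc k * (+ 2 * + t + + 1) * + weight m (suc k) ≡ + suc t * (+ m + + suc k) * + weight m k
  weight-recurrenceℤ k t = trans (sym left) (trans (cong +_ (weight-recurrence k t)) right)
    where
    m = k ℕ.+ suc t
    left : + (suc k ℕ.* (2 ℕ.* t ℕ.+ 1) ℕ.* weight m (suc k)) ≡ + suc k * (+ 2 * + t + + 1) * + weight m (suc k)
    left = trans (pos-*₃ (suc k) (2 ℕ.* t ℕ.+ 1) (weight m (suc k)))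
      (cong (λ x → + suc k * x * + weight m (suc k)) (trans (pos-+ (2 ℕ.* t) 1) (cong (_+ + 1) (pos-* 2 t))))
    right : + (suc t ℕ.* (m ℕ.+ suc k) ℕ.* weight m k) ≡ + suc t * (+ m + + suc k) * + weight m k
    right = trans (pos-*₃ (suc t) (m ℕ.+ suc k) (weight m k)) (cong (λ x → + suc t * x * + weight m k) (pos-+ m (suc k)))

  summand : ℕ → ℕ → ℕ → ℤ
  summand m j k = + weight m k * + (k C j)

  summand-nonNeg : ∀ m j k → 0ℤ ≤ summand m j k
  summand-nonNeg m j k = *-nonNeg {+ weight m k} {+ (k C j)} (+≤+ z≤n) (+≤+ z≤n)

  dSum : ℕ → ℕ → ℤ
  dSum j m = Σ (suc m) (summand m j)

  dNum≡dSum : ∀ j m → + dNum j m ≡ dSum j m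
  dNum≡dSum j m = trans (sumFromTo≡Σ j m _ below) (Σ-cong (suc m) (λ {k} _ → pos-* (weight m k) (k C j)))
    where
    below : ∀ {k} → k ℕ.< j → weight m k ℕ.* (k C j) ≡ 0
    below {k} k<j = trans (cong (weight m k ℕ.*_) (k>n⇒nCk≡0 k<j)) (ℕ.*-zeroʳ (weight m k))

  dSum-pos : ∀ {j m} → j ℕ.≤ m → 0ℤ < dSum j m
  dSum-pos {j} {m} j≤m = Σ-pos m (summand-nonNeg m j) (*-pos (+<+ (weight-pos m)) (+<+ (C-pos j≤m)))

  dSum-vanishes : ∀ m → dSum (suc m) m ≡ 0ℤ
  dSum-vanishes m = Σ-zero (suc m) λ {k} k≤m →
    trans (cong (λ c → + weight m k * + c) (k>n⇒nCk≡0 {k} {suc m} k≤m)) (*-zeroʳ (+ weight m k))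

  φ ψ : ℕ → ℕ → ℕ → ℤ
  φ n m k = + suc n * (+ 2 * + m + + 1 - + 2 * + k) * summand m (suc n) k
  ψ n m k = (+ m - + k) * (+ m + + k + + 1) * summand m n k

  recurrence-summand : ∀ n m k →
    recurrence (+ suc n) (+ m) (summand m n k) (summand m (suc n) k) (summand m (suc (suc n)) k) ≡ φ n m k - ψ n m k
  recurrence-summand n m k = eq-modulo₂ (φ n m k - ψ n m k) (- (+ suc n * + weight m k)) (+ weight m k * (+ k + + suc n))
    (identity (+ n) (+ m) (+ k) (+ weight m k) (+ (k C n)) (+ (k C suc n)) (+ (k C suc (suc n))))
    (C-stepℤ k (suc n)) (C-stepℤ k n)
    where
    identity : ∀ N M K G b₀ b₁ b₂ → let L = + 1 + N in
      recurrence L M (G * b₀) (G * b₁) (G * b₂)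
        ≡ L * (+ 2 * M + + 1 - + 2 * K) * (G * b₁) - (M - K) * (M + K + + 1) * (G * b₀)
          + - (L * G) * ((+ 1 + L) * b₂ - (K - L) * b₁) + G * (K + L) * (L * b₁ - (K - N) * b₀)
    identity = solve 7 (λ N M K G b₀ b₁ b₂ → let L = E.# 1 ⊕ N in
      E.recurrence L M (G ⊗ b₀) (G ⊗ b₁) (G ⊗ b₂)
        ⊜ (L ⊗ (E.# 2 ⊗ M ⊕ E.# 1 E.- E.# 2 ⊗ K) ⊗ (G ⊗ b₁) E.- (M E.- K) ⊗ (M ⊕ K ⊕ E.# 1) ⊗ (G ⊗ b₀)
          ⊕ ⊝ (L ⊗ G) ⊗ ((E.# 1 ⊕ L) ⊗ b₂ E.- (K E.- L) ⊗ b₁)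
          ⊕ G ⊗ (K ⊕ L) ⊗ (L ⊗ b₁ E.- (K E.- N) ⊗ b₀))) refl

  φ-suc≡ψ′ : ∀ n k t → φ n (k ℕ.+ suc t) (suc k) ≡ ψ n (k ℕ.+ suc t) k
  φ-suc≡ψ′ n k t = eq-modulo₂ (ψ n m k) ((+ 2 * + t + + 1) * + weight m (suc k)) (+ (k C n))
    (identity (+ n) (+ k) (+ t) (+ weight m k) (+ weight m (suc k)) (+ (k C n)) (+ (suc k C suc n)))
    (C-absorbℤ k n) (weight-recurrenceℤ k t)
    where
    m = k ℕ.+ suc t
    identity : ∀ N K T G G′ b₀ b₁′ → let L = + 1 + N ; M = K + (+ 1 + T) in
      L * (+ 2 * M + + 1 - + 2 * (+ 1 + K)) * (G′ * b₁′)
        ≡ (M - K) * (M + K + + 1) * (G * b₀)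
          + (+ 2 * T + + 1) * G′ * (L * b₁′ - (+ 1 + K) * b₀)
          + b₀ * ((+ 1 + K) * (+ 2 * T + + 1) * G′ - (+ 1 + T) * (M + (+ 1 + K)) * G)
    identity = solve-∀

  φ-suc≡ψ : ∀ n {m k} → k ℕ.< m → φ n m (suc k) ≡ ψ n m k
  φ-suc≡ψ n {m} {k} k<m = subst (λ m → φ n m (suc k) ≡ ψ n m k) split (φ-suc≡ψ′ n k (m ℕ.∸ suc k))
    where
    split : k ℕ.+ suc (m ℕ.∸ suc k) ≡ m
    split = trans (ℕ.+-suc k (m ℕ.∸ suc k)) (ℕ.m+[n∸m]≡n k<m)

  dSum-recurrence : ∀ n m → recurrence (+ suc n) (+ m) (dSum n m) (dSum (suc n) m) (dSum (suc (suc n)) m) ≡ 0ℤ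
  dSum-recurrence n m = begin
    recurrence L M (dSum n m) (dSum (suc n) m) (dSum (suc (suc n)) m)
      ≡⟨ Σ-recurrence (suc m) L M (summand m n) (summand m (suc n)) (summand m (suc (suc n))) ⟨
    Σ (suc m) (λ k → recurrence L M (summand m n k) (summand m (suc n) k) (summand m (suc (suc n)) k))
      ≡⟨ Σ-cong (suc m) (λ {k} _ → recurrence-summand n m k) ⟩
    Σ (suc m) (λ k → φ n m k - ψ n m k)
      ≡⟨ Σ-telescope m {φ n m} {ψ n m} (φ-suc≡ψ n) ⟩
    φ n m 0 - ψ n m m
      ≡⟨ cong₂ _-_ φ-first ψ-last ⟩
    0ℤ ∎
    where
    open ≡-Reasoning
    L = + suc n
    M = + m
    φ-first : φ n m 0 ≡ 0ℤ
    φ-first = trans (cong (L * (+ 2 * M + + 1 - + 2 * + 0) *_) (*-zeroʳ (+ weight m 0))) (*-zeroʳ (L * (+ 2 * M + + 1 - + 2 * + 0)))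
    ψ-last : ψ n m m ≡ 0ℤ
    ψ-last = cong (λ x → x * (M + M + + 1) * summand m n m) (+-inverseʳ M)

  -- Quadratic forms

  form-homogeneous : ∀ a b c x y z → form a b c (x * y) (x * z) ≡ x * x * form a b c y z
  form-homogeneous = solve 6 (λ a b c x y z → E.form a b c (x ⊗ y) (x ⊗ z) ⊜ x ⊗ x ⊗ E.form a b c y z) refl

  Q-homogeneous : ∀ L M x y z → Q L M (x * y) (x * z) ≡ x * x * Q L M y z
  Q-homogeneous L M = form-homogeneous (q₂ L M) (q₁ L M) (q₀ L M)

  R-substitution : ∀ L M u w → R L M u w ≡ Q (+ 1 + L) M ((+ 2 * M + + 1) * u - (M + L) * w) ((M - L) * u)
  R-substitution = solve 4 (λ L M u w →
    E.R L M u w ⊜ E.Q (E.# 1 ⊕ L) M ((E.# 2 ⊗ M ⊕ E.# 1) ⊗ u E.- (M ⊕ L) ⊗ w) ((M E.- L) ⊗ u)) refl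

  certificate-identity : ∀ q₂ q₁ q₀ r₂ r₁ r₀ a b u w → let open Certificate q₂ q₁ q₀ r₂ r₁ r₀ a b in
    a * b * b * (- R̂ * form q₂ q₁ q₀ u w)
      ≡ a * b * b * (- Q̂ * form r₂ r₁ r₀ u w) + (b * w - a * u) * (c₃ * u + c₁ * a * (b * w - a * u))
  certificate-identity = solve 10 (λ q₂ q₁ q₀ r₂ r₁ r₀ a b u w → let open E.Certificate q₂ q₁ q₀ r₂ r₁ r₀ a b in
    (a ⊗ b ⊗ b ⊗ (⊝ R̂ ⊗ E.form q₂ q₁ q₀ u w))
      ⊜ (a ⊗ b ⊗ b ⊗ (⊝ Q̂ ⊗ E.form r₂ r₁ r₀ u w)
         ⊕ (b ⊗ w E.- a ⊗ u) ⊗ (c₃ ⊗ u ⊕ c₁ ⊗ a ⊗ (b ⊗ w E.- a ⊗ u)))) refl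

  form-pos : ∀ {q₂ q₁ q₀ r₂ r₁ r₀ a b u w} → let open Certificate q₂ q₁ q₀ r₂ r₁ r₀ a b in
    0ℤ < - R̂ → 0ℤ ≤ - Q̂ → 0ℤ < c₁ → 0ℤ ≤ c₃ → 0ℤ < a → 0ℤ < b →
    0ℤ < u → 0ℤ ≤ form r₂ r₁ r₀ u w → 0ℤ < b * w - a * u → 0ℤ < form q₂ q₁ q₀ u w
  form-pos {q₂} {q₁} {q₀} {r₂} {r₁} {r₀} {a} {b} {u} {w} R̂<0 Q̂≤0 c₁>0 c₃≥0 a>0 b>0 u>0 R≥0 e>0 =
    0<i*j⇒0<j R̂<0 (0<i*j⇒0<j abb>0 (subst (0ℤ <_) (sym (certificate-identity q₂ q₁ q₀ r₂ r₁ r₀ a b u w)) rhs>0))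
    where
    open Certificate q₂ q₁ q₀ r₂ r₁ r₀ a b
    abb>0 : 0ℤ < a * b * b
    abb>0 = *-pos (*-pos a>0 b>0) b>0
    rhs>0 : 0ℤ < a * b * b * (- Q̂ * form r₂ r₁ r₀ u w) + (b * w - a * u) * (c₃ * u + c₁ * a * (b * w - a * u))
    rhs>0 = +-mono-≤-< (*-nonNeg (<⇒≤ abb>0) (*-nonNeg Q̂≤0 R≥0))
              (*-pos e>0 (+-mono-≤-< (*-nonNeg c₃≥0 (<⇒≤ u>0)) (*-pos (*-pos c₁>0 a>0) e>0)))

  -- Coefficients of - R̂ - 1, - Q̂, c₁ - 1 and c₃ of CertificateAt (1 + i) (2 + i + j) as polynomials
  -- in i (outer) and j (inner), lowest degree first.
  −R̂-coefficients −Q̂-coefficients c₁-coefficients c₃-coefficients : List (List ℕ)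
  −R̂-coefficients =
    (53 ∷ 144 ∷ 132 ∷ 48 ∷ 6 ∷ []) ∷ (117 ∷ 288 ∷ 230 ∷ 64 ∷ 5 ∷ []) ∷ (93 ∷ 212 ∷ 146 ∷ 28 ∷ 1 ∷ []) ∷
    (32 ∷ 68 ∷ 40 ∷ 4 ∷ []) ∷ (4 ∷ 8 ∷ 4 ∷ []) ∷ []
  −Q̂-coefficients = (0 ∷ []) ∷ (3 ∷ 4 ∷ 1 ∷ []) ∷ (5 ∷ 6 ∷ 1 ∷ []) ∷ (2 ∷ 2 ∷ []) ∷ []
  c₁-coefficients =
    (485 ∷ 1620 ∷ 2106 ∷ 1368 ∷ 474 ∷ 84 ∷ 6 ∷ []) ∷ (1863 ∷ 5535 ∷ 6210 ∷ 3318 ∷ 883 ∷ 107 ∷ 4 ∷ []) ∷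
    (3078 ∷ 8019 ∷ 7542 ∷ 3144 ∷ 580 ∷ 37 ∷ []) ∷ (2844 ∷ 6384 ∷ 4842 ∷ 1454 ∷ 154 ∷ 2 ∷ []) ∷
    (1587 ∷ 3014 ∷ 1744 ∷ 330 ∷ 13 ∷ []) ∷ (534 ∷ 842 ∷ 338 ∷ 30 ∷ []) ∷ (100 ∷ 128 ∷ 28 ∷ []) ∷
    (8 ∷ 8 ∷ []) ∷ []
  c₃-coefficients =
    (5832 ∷ 20898 ∷ 30132 ∷ 22734 ∷ 9792 ∷ 2430 ∷ 324 ∷ 18 ∷ []) ∷
    (25920 ∷ 87075 ∷ 114993 ∷ 77154 ∷ 28590 ∷ 5859 ∷ 609 ∷ 24 ∷ []) ∷
    (49626 ∷ 155601 ∷ 186219 ∷ 108710 ∷ 33404 ∷ 5313 ∷ 383 ∷ 8 ∷ []) ∷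
    (53406 ∷ 155592 ∷ 166620 ∷ 82116 ∷ 19794 ∷ 2196 ∷ 84 ∷ []) ∷
    (35292 ∷ 95130 ∷ 89790 ∷ 35736 ∷ 6164 ∷ 382 ∷ 2 ∷ []) ∷
    (14644 ∷ 36400 ∷ 29760 ∷ 8912 ∷ 924 ∷ 16 ∷ []) ∷
    (3720 ∷ 8520 ∷ 5928 ∷ 1176 ∷ 48 ∷ []) ∷ (528 ∷ 1120 ∷ 656 ∷ 64 ∷ []) ∷ (32 ∷ 64 ∷ 32 ∷ []) ∷ []

  module _ (i j : ℕ) where
    open CertificateAt (+ suc i) (+ suc (suc (i ℕ.+ j)))

    −R̂-pos : 0ℤ < - R̂
    −R̂-pos = subst (0ℤ <_) (sym (expansion (+ i) (+ j)))
      (0≤i⇒0<1+i (horner₂-nonNeg −R̂-coefficients {+ i} {+ j} (+≤+ z≤n) (+≤+ z≤n)))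
      where
      expansion : ∀ I J → - CertificateAt.R̂ (+ 1 + I) (+ 2 + I + J) ≡ + 1 + horner₂ −R̂-coefficients I J
      expansion = solve 2 (λ I J →
        E.- E.CertificateAt.R̂ (E.# 1 E.+ I) (E.# 2 E.+ I E.+ J) ⊜ (E.# 1 E.+ E.horner₂ −R̂-coefficients I J)) refl

    −Q̂-nonNeg : 0ℤ ≤ - Q̂
    −Q̂-nonNeg = subst (0ℤ ≤_) (sym (expansion (+ i) (+ j)))
      (horner₂-nonNeg −Q̂-coefficients {+ i} {+ j} (+≤+ z≤n) (+≤+ z≤n))
      where
      expansion : ∀ I J → - CertificateAt.Q̂ (+ 1 + I) (+ 2 + I + J) ≡ horner₂ −Q̂-coefficients I J
      expansion = solve 2 (λ I J →
        E.- E.CertificateAt.Q̂ (E.# 1 E.+ I) (E.# 2 E.+ I E.+ J) ⊜ E.horner₂ −Q̂-coefficients I J) refl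

    c₁-pos : 0ℤ < c₁
    c₁-pos = subst (0ℤ <_) (sym (expansion (+ i) (+ j)))
      (0≤i⇒0<1+i (horner₂-nonNeg c₁-coefficients {+ i} {+ j} (+≤+ z≤n) (+≤+ z≤n)))
      where
      expansion : ∀ I J → CertificateAt.c₁ (+ 1 + I) (+ 2 + I + J) ≡ + 1 + horner₂ c₁-coefficients I J
      expansion = solve 2 (λ I J →
        E.CertificateAt.c₁ (E.# 1 E.+ I) (E.# 2 E.+ I E.+ J) ⊜ (E.# 1 E.+ E.horner₂ c₁-coefficients I J)) refl

    c₃-nonNeg : 0ℤ ≤ c₃
    c₃-nonNeg = subst (0ℤ ≤_) (sym (expansion (+ i) (+ j)))
      (horner₂-nonNeg c₃-coefficients {+ i} {+ j} (+≤+ z≤n) (+≤+ z≤n))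
      where
      expansion : ∀ I J → CertificateAt.c₃ (+ 1 + I) (+ 2 + I + J) ≡ horner₂ c₃-coefficients I J
      expansion = solve 2 (λ I J →
        E.CertificateAt.c₃ (E.# 1 E.+ I) (E.# 2 E.+ I E.+ J) ⊜ E.horner₂ c₃-coefficients I J) refl

    Q-pos : ∀ {u w} → let L = + suc i ; M = + suc (suc (i ℕ.+ j)) in
      0ℤ < u → 0ℤ ≤ R L M u w → 0ℤ < (M + L) * w - (M + L + + 1) * u → 0ℤ < Q L M u w
    Q-pos {u} {w} = form-pos {q₂ L M} {q₁ L M} {q₀ L M} {r₂ L M} {r₁ L M} {r₀ L M} {M + L + + 1} {M + L} {u} {w}
      −R̂-pos −Q̂-nonNeg c₁-pos c₃-nonNeg (+<+ (s≤s z≤n)) (+<+ (s≤s z≤n))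
      where
      L = + suc i
      M = + suc (suc (i ℕ.+ j))

  -- Descent

  -- The second component is what makes (M+L)w - (M+L+1)u positive one step further down.
  Invariant : ℤ → ℤ → ℤ → ℤ → Set
  Invariant L M x₀ x₁ = 0ℤ ≤ Q L M (L * x₁) ((M - L + + 1) * x₀) × L * x₁ < (M - L + + 1) * x₀

  invariant-top : ∀ n {x₀ x₁} → let M = + suc n in
    0ℤ < x₁ → recurrence M M x₀ x₁ 0ℤ ≡ 0ℤ → Invariant M M x₀ x₁
  invariant-top n {x₀} {x₁} x₁>0 rec≡0 = subst (0ℤ ≤_) (sym Q≡0) (+≤+ z≤n) , 0<j-i⇒i<j (0<i*j⇒0<j 2M>0 gap)
    where
    M = + suc n
    Q≡0 : Q M M (M * x₁) ((M - M + + 1) * x₀) ≡ 0ℤ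
    Q≡0 = eq-modulo 0ℤ (- ((M + M * M) * x₀)) (identity M x₀ x₁) rec≡0
      where
      identity : ∀ M x₀ x₁ →
        Q M M (M * x₁) ((M - M + + 1) * x₀) ≡ 0ℤ + - ((M + M * M) * x₀) * (recurrence M M x₀ x₁ 0ℤ - 0ℤ)
      identity = solve 3 (λ M x₀ x₁ → E.Q M M (M ⊗ x₁) ((M E.- M ⊕ E.# 1) ⊗ x₀)
        ⊜ (E.# 0 ⊕ ⊝ ((M ⊕ M ⊗ M) ⊗ x₀) ⊗ (E.recurrence M M x₀ x₁ (E.# 0) E.- E.# 0))) refl
    2M>0 : 0ℤ < M + M
    2M>0 = +<+ (s≤s z≤n)
    gap : 0ℤ < (M + M) * ((M - M + + 1) * x₀ - M * x₁)
    gap = subst (0ℤ <_) (sym (eq-modulo (M * x₁) (- + 1) (identity M x₀ x₁) rec≡0)) (*-pos {M} (+<+ (s≤s z≤n)) x₁>0)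
      where
      identity : ∀ M x₀ x₁ →
        (M + M) * ((M - M + + 1) * x₀ - M * x₁) ≡ M * x₁ + - + 1 * (recurrence M M x₀ x₁ 0ℤ - 0ℤ)
      identity = solve 3 (λ M x₀ x₁ → (M ⊕ M) ⊗ ((M E.- M ⊕ E.# 1) ⊗ x₀ E.- M ⊗ x₁)
        ⊜ (M ⊗ x₁ ⊕ ⊝ E.# 1 ⊗ (E.recurrence M M x₀ x₁ (E.# 0) E.- E.# 0))) refl

  invariant-step : ∀ i j {x₀ x₁ x₂} → let L = + suc i ; M = + suc (suc (i ℕ.+ j)) in
    0ℤ < x₁ → recurrence L M x₀ x₁ x₂ ≡ 0ℤ → Invariant (+ 1 + L) M x₁ x₂ →
    0ℤ < Q L M (L * x₁) ((M - L + + 1) * x₀) × L * x₁ < (M - L + + 1) * x₀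
  invariant-step i j {x₀} {x₁} {x₂} x₁>0 rec≡0 (Q′≥0 , u′<w′) =
    Q-pos i j u>0 R≥0 e>0 , 0<j-i⇒i<j (0<i*j⇒0<j b>0 w-u>0)
    where
    L = + suc i
    M = + suc (suc (i ℕ.+ j))
    u = L * x₁
    w = (M - L + + 1) * x₀
    u′ = (+ 1 + L) * x₂
    w′ = (M - (+ 1 + L) + + 1) * x₁
    L>0 : 0ℤ < L
    L>0 = +<+ (s≤s z≤n)
    b>0 : 0ℤ < M + L
    b>0 = +<+ (s≤s z≤n)
    u>0 : 0ℤ < u
    u>0 = *-pos L>0 x₁>0
    Lu′ : L * u′ ≡ (+ 2 * M + + 1) * u - (M + L) * w
    Lu′ = eq-modulo _ (- + 1) (identity L M x₀ x₁ x₂) rec≡0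
      where
      identity : ∀ L M x₀ x₁ x₂ → L * ((+ 1 + L) * x₂)
        ≡ (+ 2 * M + + 1) * (L * x₁) - (M + L) * ((M - L + + 1) * x₀) + - + 1 * (recurrence L M x₀ x₁ x₂ - 0ℤ)
      identity = solve 5 (λ L M x₀ x₁ x₂ → L ⊗ ((E.# 1 ⊕ L) ⊗ x₂)
        ⊜ ((E.# 2 ⊗ M ⊕ E.# 1) ⊗ (L ⊗ x₁) E.- (M ⊕ L) ⊗ ((M E.- L ⊕ E.# 1) ⊗ x₀)
           ⊕ ⊝ E.# 1 ⊗ (E.recurrence L M x₀ x₁ x₂ E.- E.# 0))) refl
    Lw′ : L * w′ ≡ (M - L) * u
    Lw′ = identity L M x₁
      where
      identity : ∀ L M x₁ → L * ((M - (+ 1 + L) + + 1) * x₁) ≡ (M - L) * (L * x₁)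
      identity = solve-∀
    R≥0 : 0ℤ ≤ R L M u w
    R≥0 = subst (0ℤ ≤_) (sym (begin
      R L M u w                                                       ≡⟨ R-substitution L M u w ⟩
      Q (+ 1 + L) M ((+ 2 * M + + 1) * u - (M + L) * w) ((M - L) * u) ≡⟨ cong₂ (Q (+ 1 + L) M) Lu′ Lw′ ⟨
      Q (+ 1 + L) M (L * u′) (L * w′)                                 ≡⟨ Q-homogeneous (+ 1 + L) M L u′ w′ ⟩
      L * L * Q (+ 1 + L) M u′ w′                                     ∎))
      (*-nonNeg (*-nonNeg (<⇒≤ L>0) (<⇒≤ L>0)) Q′≥0)
      where open ≡-Reasoning
    e>0 : 0ℤ < (M + L) * w - (M + L + + 1) * u
    e>0 = subst (0ℤ <_) (sym (begin
      (M + L) * w - (M + L + + 1) * u                   ≡⟨ regroup L M u w ⟩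
      (M - L) * u - ((+ 2 * M + + 1) * u - (M + L) * w) ≡⟨ cong₂ _-_ Lw′ Lu′ ⟨
      L * w′ - L * u′                                   ≡⟨ factor L w′ u′ ⟩
      L * (w′ - u′)                                     ∎))
      (*-pos L>0 (i<j⇒0<j-i u′<w′))
      where
      open ≡-Reasoning
      regroup : ∀ L M u w → (M + L) * w - (M + L + + 1) * u ≡ (M - L) * u - ((+ 2 * M + + 1) * u - (M + L) * w)
      regroup = solve-∀
      factor : ∀ L a b → L * a - L * b ≡ L * (a - b)
      factor = solve-∀
    w-u>0 : 0ℤ < (M + L) * (w - u)
    w-u>0 = subst (0ℤ <_) (sym (split L M u w)) (+-mono-≤-< (<⇒≤ e>0) u>0)
      where
      split : ∀ L M u w → (M + L) * (w - u) ≡ (M + L) * w - (M + L + + 1) * u + u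
      split = solve-∀

  invariant : ∀ j n → let m = suc (n ℕ.+ j) in Invariant (+ suc n) (+ m) (dSum n m) (dSum (suc n) m)
  invariant zero n = subst (λ m → Invariant (+ suc n) (+ m) (dSum n m) (dSum (suc n) m)) (cong suc (sym (ℕ.+-identityʳ n)))
    (invariant-top n (dSum-pos {suc n} {suc n} ℕ.≤-refl) top-recurrence)
    where
    M = + suc n
    top-recurrence : recurrence M M (dSum n (suc n)) (dSum (suc n) (suc n)) 0ℤ ≡ 0ℤ
    top-recurrence = subst (λ x → recurrence M M (dSum n (suc n)) (dSum (suc n) (suc n)) x ≡ 0ℤ)
      (dSum-vanishes (suc n)) (dSum-recurrence n (suc n))
  invariant (suc j) n = subst (λ m → Invariant (+ suc n) (+ m) (dSum n m) (dSum (suc n) m)) (cong suc (sym (ℕ.+-suc n j)))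
    (map₁ <⇒≤ (invariant-step n j (dSum-pos (s≤s (ℕ.m≤n⇒m≤1+n (ℕ.m≤m+n n j))))
      (dSum-recurrence n (suc (suc (n ℕ.+ j)))) (invariant j (suc n))))

  ratio-inequalityℤ : ∀ i j → let ℓ = suc i ; m = suc (suc (i ℕ.+ j)) ; L = + ℓ ; M = + m in
    bound-numerator L M * (dSum i m * dSum (suc ℓ) m) < bound-denominator L M * (dSum ℓ m * dSum ℓ m)
  ratio-inequalityℤ i j = 0<j-i⇒i<j (0<i*j⇒0<j {L} (+<+ (s≤s z≤n)) (subst (0ℤ <_) (sym difference) Q>0))
    where
    ℓ = suc i
    m = suc (suc (i ℕ.+ j))
    L = + ℓ
    M = + m
    x₀ = dSum i m
    x₁ = dSum ℓ m
    x₂ = dSum (suc ℓ) m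
    Q>0 : 0ℤ < Q L M (L * x₁) ((M - L + + 1) * x₀)
    Q>0 = proj₁ (invariant-step i j (dSum-pos (s≤s (ℕ.m≤n⇒m≤1+n (ℕ.m≤m+n i j)))) (dSum-recurrence i m) (invariant j ℓ))
    difference : L * (bound-denominator L M * (x₁ * x₁) - bound-numerator L M * (x₀ * x₂))
               ≡ Q L M (L * x₁) ((M - L + + 1) * x₀)
    difference = eq-modulo _ ((M - L + + 1) * (M + L * L) * x₀) (identity L M x₀ x₁ x₂) (dSum-recurrence i m)
      where
      identity : ∀ L M x₀ x₁ x₂ → L * (bound-denominator L M * (x₁ * x₁) - bound-numerator L M * (x₀ * x₂))
        ≡ Q L M (L * x₁) ((M - L + + 1) * x₀) + (M - L + + 1) * (M + L * L) * x₀ * (recurrence L M x₀ x₁ x₂ - 0ℤ)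
      identity = solve 5 (λ L M x₀ x₁ x₂ →
        L ⊗ (E.bound-denominator L M ⊗ (x₁ ⊗ x₁) E.- E.bound-numerator L M ⊗ (x₀ ⊗ x₂))
        ⊜ (E.Q L M (L ⊗ x₁) ((M E.- L ⊕ E.# 1) ⊗ x₀)
           ⊕ (M E.- L ⊕ E.# 1) ⊗ (M ⊕ L ⊗ L) ⊗ x₀ ⊗ (E.recurrence L M x₀ x₁ x₂ E.- E.# 0))) refl

module Rationals where

  open import Data.Nat as ℕ using ()
  import Data.Nat.Properties as ℕ
  open import Data.Integer as ℤ using (+_; +<+)
  import Data.Integer.Properties as ℤ
  open import Data.Rational using (0ℚ; _/_; _*_; _<_; toℚᵘ; _≟_; 1/_; Positive; ≢-nonZero)
  open import Data.Rational.Properties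
  open import Data.Rational.Unnormalised as ᵘ using (ℚᵘ; mkℚᵘ; *<*)
  import Data.Rational.Unnormalised.Properties as ᵘ

  toℚᵘ-/ : ∀ i n → toℚᵘ (i / suc n) ᵘ.≃ mkℚᵘ i n
  toℚᵘ-/ i n = toℚᵘ-fromℚᵘ (mkℚᵘ i n)

  scale-< : ∀ {x y k k′} → k ≡ k′ → x ℤ.< y → x ℤ.* + suc k ℤ.< y ℤ.* + suc k′
  scale-< {k = k} refl x<y = ℤ.*-monoʳ-<-pos (+ suc k) x<y

  cross-< : ∀ N₁ N₂ a b c D → N₁ ℕ.* (a ℕ.* c) ℕ.< N₂ ℕ.* (b ℕ.* b) →
    ι N₁ * (+ a / suc D * (+ c / suc D)) < (+ b / suc D * (+ b / suc D)) * ι N₂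
  cross-< N₁ N₂ a b c D h =
    toℚᵘ-cancel-< (ᵘ.<-respˡ-≃ (ᵘ.≃-sym left) (ᵘ.<-respʳ-≃ (ᵘ.≃-sym right) unnormalised))
    where
    ⟪_⟫ : ℕ → ℚᵘ
    ⟪ x ⟫ = mkℚᵘ (+ x) D
    left : toℚᵘ (ι N₁ * (+ a / suc D * (+ c / suc D))) ᵘ.≃ mkℚᵘ (+ N₁) 0 ᵘ.* (⟪ a ⟫ ᵘ.* ⟪ c ⟫)
    left = ᵘ.≃-trans (toℚᵘ-homo-* (ι N₁) (+ a / suc D * (+ c / suc D)))
      (ᵘ.*-cong (toℚᵘ-/ (+ N₁) 0)
        (ᵘ.≃-trans (toℚᵘ-homo-* (+ a / suc D) (+ c / suc D)) (ᵘ.*-cong (toℚᵘ-/ (+ a) D) (toℚᵘ-/ (+ c) D))))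
    right : toℚᵘ ((+ b / suc D * (+ b / suc D)) * ι N₂) ᵘ.≃ (⟪ b ⟫ ᵘ.* ⟪ b ⟫) ᵘ.* mkℚᵘ (+ N₂) 0
    right = ᵘ.≃-trans (toℚᵘ-homo-* (+ b / suc D * (+ b / suc D)) (ι N₂))
      (ᵘ.*-cong (ᵘ.≃-trans (toℚᵘ-homo-* (+ b / suc D) (+ b / suc D)) (ᵘ.*-cong (toℚᵘ-/ (+ b) D) (toℚᵘ-/ (+ b) D)))
        (toℚᵘ-/ (+ N₂) 0))
    numerators : + N₁ ℤ.* (+ a ℤ.* + c) ℤ.< + b ℤ.* + b ℤ.* + N₂
    numerators = subst₂ ℤ._<_ (trans (ℤ.pos-* N₁ (a ℕ.* c)) (cong (+ N₁ ℤ.*_) (ℤ.pos-* a c)))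
      (trans (cong +_ (ℕ.*-comm N₂ (b ℕ.* b))) (Integers.pos-*₃ b b N₂)) (+<+ h)
    unnormalised : mkℚᵘ (+ N₁) 0 ᵘ.* (⟪ a ⟫ ᵘ.* ⟪ c ⟫) ᵘ.< (⟪ b ⟫ ᵘ.* ⟪ b ⟫) ᵘ.* mkℚᵘ (+ N₂) 0
    unnormalised = *<* (scale-< (cong ℕ.pred (ℕ.*-comm (suc D ℕ.* suc D) 1)) numerators)

  ÷'-inverseʳ : ∀ p q .{{_ : Positive q}} → (p ÷' q) * q ≡ p
  ÷'-inverseʳ p q with q ≟ 0ℚ
  ... | yes q≡0 = contradiction (sym q≡0) (<⇒≢ (positive⁻¹ q))
  ... | no q≢0  = trans (*-assoc p (1/ q) q) (trans (cong (p *_) (*-inverseˡ q)) (*-identityʳ p))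
    where instance _ = ≢-nonZero q≢0

  ÷'-<-÷' : ∀ {p q r s} .{{_ : Positive q}} .{{_ : Positive s}} → p * s < r * q → p ÷' q < r ÷' s
  ÷'-<-÷' {p} {q} {r} {s} ps<rq =
    *-cancelʳ-<-nonNeg (q * s) {{pos⇒nonNeg (q * s) {{pos*pos⇒pos q s}}}} (subst₂ _<_ left right ps<rq)
    where
    left : p * s ≡ (p ÷' q) * (q * s)
    left = trans (cong (_* s) (sym (÷'-inverseʳ p q))) (*-assoc (p ÷' q) q s)
    right : r * q ≡ (r ÷' s) * (q * s)
    right = trans (cong (_* q) (sym (÷'-inverseʳ r s))) (trans (*-assoc (r ÷' s) s q) (cong ((r ÷' s) *_) (*-comm s q)))

  ratio-< : ∀ N₁ N₂ a b c D .{{_ : ℕ.NonZero D}} →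
    0 ℕ.< a → 0 ℕ.< c → N₁ ℕ.* (a ℕ.* c) ℕ.< N₂ ℕ.* (b ℕ.* b) →
    ι N₁ ÷' ι N₂ < (+ b / D * (+ b / D)) ÷' (+ a / D * (+ c / D))
  ratio-< N₁ zero a b c D _ _ h = contradiction h ℕ.n≮0
  ratio-< N₁ N₂@(suc _) a@(suc _) b c@(suc _) D@(suc D′) _ _ h =
    ÷'-<-÷' {ι N₁} {ι N₂} {+ b / D * (+ b / D)} {+ a / D * (+ c / D)} (cross-< N₁ N₂ a b c D′ h)
    where
    instance
      _ : Positive (ι N₂)
      _ = normalize-pos N₂ 1
      _ : Positive (+ a / D * (+ c / D))
      _ = pos*pos⇒pos (+ a / D) {{normalize-pos a D}} (+ c / D) {{normalize-pos c D}}

open import Data.Nat using (ℕ; suc; _≤_; _∸_; _+_; _*_; _^_)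
open import Data.Rational using (_<_)
import Data.Rational as Q

open import Data.Nat as ℕ using ()
import Data.Nat.Properties as ℕ
open import Data.Integer as ℤ using (+_; 0ℤ)
import Data.Integer.Properties as ℤ
open Polynomials Integers.ℤ-arithmetic using (bound-numerator; bound-denominator)
open Integers using (dSum; dNum≡dSum; dSum-pos; pos-*₃; ratio-inequalityℤ)
open Rationals using (ratio-<)

pos-∸ : ∀ {a b} → b ≤ a → + (a ∸ b) ≡ + a ℤ.- + b
pos-∸ {a} {b} b≤a = trans (sym (ℤ.⊖-≥ b≤a)) (sym (ℤ.m-n≡m⊖n a b))

pos-^2 : ∀ n → + (n ^ 2) ≡ + n ℤ.* + n
pos-^2 n = trans (cong (λ k → + (n * k)) (ℕ.*-identityʳ n)) (ℤ.pos-* n n)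

dNum-pos : ∀ {j m} → j ≤ m → 0 ℕ.< dNum j m
dNum-pos {j} {m} j≤m = ℤ.drop‿+<+ (subst (0ℤ ℤ.<_) (sym (dNum≡dSum j m)) (dSum-pos j≤m))

data Admissible : ℕ → ℕ → Set where
  admissible : ∀ i j → Admissible (suc i) (suc (suc (i + j)))

admissible? : ∀ {m ℓ} → 2 ≤ m → 1 ≤ ℓ → ℓ ≤ m ∸ 1 → Admissible ℓ m
admissible? {suc (suc m′)} {suc i} _ _ (s≤s i≤m′) =
  subst (λ k → Admissible (suc i) (suc (suc k))) (ℕ.m+[n∸m]≡n i≤m′) (admissible i (m′ ∸ i))

ratio-inequalityℕ : ∀ i j → let ℓ = suc i ; m = suc (suc (i + j)) in
  (suc m ∸ ℓ) * (ℓ + 1) * (m + ℓ ^ 2) * (dNum (ℓ ∸ 1) m * dNum (ℓ + 1) m)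
    ℕ.< (m ∸ ℓ) * ℓ * (m + ℓ ^ 2 + 1) * (dNum ℓ m * dNum ℓ m)
ratio-inequalityℕ i j = ℤ.drop‿+<+ (subst₂ ℤ._<_ (sym left) (sym right) (ratio-inequalityℤ i j))
  where
  ℓ = suc i
  m = suc (suc (i + j))
  ℓ≤m : ℓ ≤ m
  ℓ≤m = s≤s (ℕ.m≤n⇒m≤1+n (ℕ.m≤m+n i j))
  square : + (m + ℓ ^ 2) ≡ + m ℤ.+ + ℓ ℤ.* + ℓ
  square = trans (ℤ.pos-+ m (ℓ ^ 2)) (cong (ℤ._+_ (+ m)) (pos-^2 ℓ))
  numerator : + ((suc m ∸ ℓ) * (ℓ + 1) * (m + ℓ ^ 2)) ≡ bound-numerator (+ ℓ) (+ m)
  numerator = trans (pos-*₃ (suc m ∸ ℓ) (ℓ + 1) (m + ℓ ^ 2))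
    (cong₂ ℤ._*_ (cong₂ ℤ._*_ (pos-∸ (ℕ.m≤n⇒m≤1+n ℓ≤m)) (ℤ.pos-+ ℓ 1)) square)
  denominator : + ((m ∸ ℓ) * ℓ * (m + ℓ ^ 2 + 1)) ≡ bound-denominator (+ ℓ) (+ m)
  denominator = trans (pos-*₃ (m ∸ ℓ) ℓ (m + ℓ ^ 2 + 1))
    (cong₂ (λ x z → x ℤ.* + ℓ ℤ.* z) (pos-∸ ℓ≤m)
      (trans (ℤ.pos-+ (m + ℓ ^ 2) 1) (cong (λ x → x ℤ.+ + 1) square)))
  left : + ((suc m ∸ ℓ) * (ℓ + 1) * (m + ℓ ^ 2) * (dNum i m * dNum (ℓ + 1) m))
       ≡ bound-numerator (+ ℓ) (+ m) ℤ.* (dSum i m ℤ.* dSum (suc ℓ) m)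
  left = trans (ℤ.pos-* ((suc m ∸ ℓ) * (ℓ + 1) * (m + ℓ ^ 2)) (dNum i m * dNum (ℓ + 1) m)) (cong₂ ℤ._*_ numerator
    (trans (ℤ.pos-* (dNum i m) (dNum (ℓ + 1) m))
      (cong₂ ℤ._*_ (dNum≡dSum i m) (trans (cong (λ k → + dNum k m) (ℕ.+-comm ℓ 1)) (dNum≡dSum (suc ℓ) m)))))
  right : + ((m ∸ ℓ) * ℓ * (m + ℓ ^ 2 + 1) * (dNum ℓ m * dNum ℓ m))
        ≡ bound-denominator (+ ℓ) (+ m) ℤ.* (dSum ℓ m ℤ.* dSum ℓ m)
  right = trans (ℤ.pos-* ((m ∸ ℓ) * ℓ * (m + ℓ ^ 2 + 1)) (dNum ℓ m * dNum ℓ m)) (cong₂ ℤ._*_ denominator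
    (trans (ℤ.pos-* (dNum ℓ m) (dNum ℓ m)) (cong₂ ℤ._*_ (dNum≡dSum ℓ m) (dNum≡dSum ℓ m))))

theorem3p1 : (m ℓ : ℕ) → 2 ≤ m → 1 ≤ ℓ → ℓ ≤ m ∸ 1 →
    (ι ((suc m ∸ ℓ) * (ℓ + 1) * (m + ℓ ^ 2)) ÷' ι ((m ∸ ℓ) * ℓ * (m + ℓ ^ 2 + 1)))
      < ((d ℓ m Q.* d ℓ m) ÷' (d (ℓ ∸ 1) m Q.* d (ℓ + 1) m))
theorem3p1 m ℓ 2≤m 1≤ℓ ℓ≤m-1 with admissible? 2≤m 1≤ℓ ℓ≤m-1
... | admissible i j =
  ratio-< ((suc m ∸ ℓ) * (ℓ + 1) * (m + ℓ ^ 2)) ((m ∸ ℓ) * ℓ * (m + ℓ ^ 2 + 1))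
          (dNum (ℓ ∸ 1) m) (dNum ℓ m) (dNum (ℓ + 1) m) (2 ^ (2 * m)) {{ℕ.>-nonZero (ℕ.m^n>0 2 (2 * m))}}
          (dNum-pos (ℕ.m≤n⇒m≤1+n (ℕ.m≤n⇒m≤1+n (ℕ.m≤m+n i j)))) (dNum-pos ℓ+1≤m) (ratio-inequalityℕ i j)
  where
  ℓ+1≤m : suc i + 1 ≤ m
  ℓ+1≤m = subst (_≤ m) (ℕ.+-comm 1 (suc i)) (s≤s (s≤s (ℕ.m≤m+n i j)))
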